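{- For every integer $n>0$, the Hochschild lattice $\mathrm{Hoch}(n)$ has order dimension $n$.
   Context: For a finite directed graph $G$, an orthogonal pair is a pair $(X,Y)$ of disjoint vertex sets with no edge from a vertex of $X$ to a vertex of $Y$; a maximal orthogonal pair is one maximal for componentwise inclusion. $L(G)$ is the set of maximal orthogonal pairs ordered by $(X,Y)\le(X',Y')$ iff $X\subseteq X'$. $\mathrm{Hoch}(n)=L(G_n)$, where $G_n$ has vertices $\{(i,j)\mid i\in\{1,2\},\ i\le j\le n\}$ and an edge $(i,j)\to(i',j')$, for $(i,j)\neq(i',j')$, iff either ($i=2$, $i'=1$, $j=j'$) or ($i=i'=1$ and $j>j'$). The order dimension of a poset $P$ is the smallest $d$ such that $P$ is isomorphic to a subposet of $\mathbb R^d$ with componentwise order.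
   Formalization: The order dimension is defined through order embeddings into ℚ^d with the componentwise order, in place of ℝ^d. -}

module Defs where

open import Level using (Level; _⊔_; suc)
open import Data.Nat using (ℕ; _≤_; _<_)
open import Data.Fin using (Fin; toℕ)
open import Data.Bool using (Bool; true)
open import Data.Product using (Σ; Σ-syntax; _×_; proj₁; proj₂)
open import Data.Sum using (_⊎_)
open import Data.Empty using (⊥)
open import Relation.Nullary using (¬_)
open import Relation.Binary.PropositionalEquality using (_≡_)
open import Function.Bundles using (_⇔_)
import Data.Rational as ℚ

record Digraph : Set₁ where
  field
    V : Set
    E : V → V → Set

module _ (G : Digraph) where
  open Digraph G

  VSet : Set
  VSet = V → Bool

  _∈_ : V → VSet → Set
  v ∈ X = X v ≡ true

  _⊆_ : VSet → VSet → Set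
  X ⊆ Y = ∀ v → v ∈ X → v ∈ Y

  Orthogonal : VSet → VSet → Set
  Orthogonal X Y =
    (∀ v → v ∈ X → v ∈ Y → ⊥) ×
    (∀ x y → x ∈ X → y ∈ Y → ¬ E x y)

  MaximalOrthogonal : VSet → VSet → Set
  MaximalOrthogonal X Y =
    Orthogonal X Y ×
    (∀ X′ Y′ → Orthogonal X′ Y′ → X ⊆ X′ → Y ⊆ Y′ → (X′ ⊆ X) × (Y′ ⊆ Y))

  L : Set
  L = Σ[ p ∈ VSet × VSet ] MaximalOrthogonal (proj₁ p) (proj₂ p)

  _≤L_ : L → L → Set
  p ≤L q = proj₁ (proj₁ p) ⊆ proj₁ (proj₁ q)

-- The graph G_n (0-indexed: vertex (i,j) of the paper is (i-1, j-1))

GV : ℕ → Set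
GV n = Σ[ p ∈ Fin 2 × Fin n ] toℕ (proj₁ p) ≤ toℕ (proj₂ p)

row : ∀ {n} → GV n → ℕ
row v = toℕ (proj₁ (proj₁ v))

col : ∀ {n} → GV n → ℕ
col v = toℕ (proj₂ (proj₁ v))

-- edge (i,j) → (i',j') iff (i = 2, i' = 1, j = j') or (i = i' = 1, j > j')
-- (both alternatives force (i,j) ≠ (i',j'))
GE : ∀ {n} → GV n → GV n → Set
GE v w = (row v ≡ 1 × row w ≡ 0 × col v ≡ col w)
       ⊎ (row v ≡ 0 × row w ≡ 0 × col w < col v)

G : ℕ → Digraph
G n = record { V = GV n ; E = GE }

Hoch : ℕ → Set
Hoch n = L (G n)

_≤Hoch_ : ∀ {n} → Hoch n → Hoch n → Set
_≤Hoch_ {n} = _≤L_ (G n)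

-- Order dimension (embeddings into ℚ^d with the componentwise order;
-- for finite posets this is equivalent to ℝ^d)

_≤ᵈ_ : ∀ {d} → (Fin d → ℚ.ℚ) → (Fin d → ℚ.ℚ) → Set
x ≤ᵈ y = ∀ k → x k ℚ.≤ y k

EmbedsIn : ∀ {a b} (P : Set a) (_≤P_ : P → P → Set b) → ℕ → Set (a ⊔ b)
EmbedsIn P _≤P_ d =
  Σ[ f ∈ (P → Fin d → ℚ.ℚ) ] (∀ x y → (x ≤P y) ⇔ (f x ≤ᵈ f y))

OrderDimension : ∀ {a b} (P : Set a) (_≤P_ : P → P → Set b) → ℕ → Set (a ⊔ b)
OrderDimension P _≤P_ d =
  EmbedsIn P _≤P_ d × (∀ d′ → EmbedsIn P _≤P_ d′ → d ≤ d′)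

{-# OPTIONS --safe #-}
-- In a maximal orthogonal pair (X , Y) of G n, X meets the first row in an initial
-- segment: the edges of that row are transitive, so a vertex to the left of one in X
-- has no edge into Y, and maximality puts it into X. Hence X is determined by the
-- length of that segment and by which of the n - 1 second-row vertices it contains,
-- and these n numbers embed Hoch n into ℕⁿ. Conversely, the pairs whose X is {(1,1)} or
-- {(2,j)}, and the largest pairs whose X avoids that vertex, form a standard example of
-- size n: every lower i ≰ upper i is witnessed at some coordinate, and two of them can
-- never share one, so an embedding needs n coordinates.
module Submission where

open import Defs
open import Data.Nat using (ℕ; _<_; _≤_; z≤n; s≤s; _<?_)

open import Level using (_⊔_)
open import Data.Bool using (Bool; true; false; not; _∧_; _∨_; if_then_else_)
import Data.Bool as Bool
open import Data.Bool.Properties using (∨-zeroʳ; T-≡; ¬-not; not-¬)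
open import Data.Empty using (⊥; ⊥-elim)
open import Data.Fin as Fin using (Fin; zero; suc; toℕ; fromℕ<)
import Data.Fin.Properties as Finₚ
open import Data.Integer using (+_; +≤+)
import Data.Integer as ℤ
import Data.Integer.Properties as ℤₚ
import Data.Nat as ℕ
import Data.Nat.Properties as ℕₚ
open import Data.Product using (∃-syntax; _×_; _,_; proj₁; proj₂)
import Data.Rational as ℚ
open import Data.Rational.Literals using (fromℤ)
import Data.Rational.Properties as ℚₚ
open import Data.Sum using (_⊎_; inj₁; inj₂)
open import Function using (_∘_)
open import Function.Bundles using (_⇔_; mk⇔; Equivalence)
open import Relation.Nullary using (¬_; yes; no; does; contradiction; ofʸ; ofⁿ)
open import Relation.Nullary.Decidable using (dec-true)
open import Relation.Binary.PropositionalEquality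

fromℕ : ℕ → ℚ.ℚ
fromℕ n = fromℤ (+ n)

fromℕ-mono-≤ : ∀ {m n} → m ≤ n → fromℕ m ℚ.≤ fromℕ n
fromℕ-mono-≤ {m} {n} m≤n =
  ℚ.*≤* (subst₂ ℤ._≤_ (sym (ℤₚ.*-identityʳ (+ m))) (sym (ℤₚ.*-identityʳ (+ n))) (+≤+ m≤n))

fromℕ-cancel-≤ : ∀ {m n} → fromℕ m ℚ.≤ fromℕ n → m ≤ n
fromℕ-cancel-≤ {m} {n} (ℚ.*≤* le) =
  ℤₚ.drop‿+≤+ (subst₂ ℤ._≤_ (ℤₚ.*-identityʳ (+ m)) (ℤₚ.*-identityʳ (+ n)) le)

EmbedsIn-viaℕ : ∀ {a b} {P : Set a} {_≤P_ : P → P → Set b} {d} (f : P → Fin d → ℕ) →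
                (∀ x y → x ≤P y ⇔ (∀ k → f x k ≤ f y k)) → EmbedsIn P _≤P_ d
EmbedsIn-viaℕ f f-embeds = (λ x k → fromℕ (f x k)) , λ x y →
  mk⇔ (λ x≤y k → fromℕ-mono-≤ (Equivalence.to (f-embeds x y) x≤y k))
      (λ fx≤fy → Equivalence.from (f-embeds x y) (λ k → fromℕ-cancel-≤ (fx≤fy k)))

noCrossing : ∀ {d} {x y x′ y′ : Fin d → ℚ.ℚ} k →
             y k ℚ.< x k → y′ k ℚ.< x′ k → x ≤ᵈ y′ → x′ ≤ᵈ y → ⊥
noCrossing {x = x} {y} {x′} {y′} k yk<xk y′k<x′k x≤y′ x′≤y = ℚₚ.<-irrefl refl (begin-strict
  y k   <⟨ yk<xk ⟩
  x k   ≤⟨ x≤y′ k ⟩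
  y′ k  <⟨ y′k<x′k ⟩
  x′ k  ≤⟨ x′≤y k ⟩
  y k   ∎)
  where open ℚₚ.≤-Reasoning

record StandardExample {a b} (P : Set a) (_≤P_ : P → P → Set b) (m : ℕ) : Set (a ⊔ b) where
  field
    lower upper : Fin m → P
    lower≤upper : ∀ {i j} → i ≢ j → lower i ≤P upper j
    lower≰upper : ∀ i → ¬ lower i ≤P upper i

standardExample⇒≤dimension : ∀ {a b} {P : Set a} {_≤P_ : P → P → Set b} {m d} →
                             StandardExample P _≤P_ m → EmbedsIn P _≤P_ d → m ≤ d
standardExample⇒≤dimension {_≤P_ = _≤P_} {d = d} S (f , f-embeds) =
  Finₚ.injective⇒≤ separating-injective
  where
  open StandardExample S

  separating : ∀ i → ∃[ k ] ¬ f (lower i) k ℚ.≤ f (upper i) k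
  separating i = Finₚ.¬∀⟶∃¬ d _ (λ k → f (lower i) k ℚₚ.≤? f (upper i) k)
                   (lower≰upper i ∘ Equivalence.from (f-embeds (lower i) (upper i)))

  separatedAt : ∀ i → f (upper i) (proj₁ (separating i)) ℚ.< f (lower i) (proj₁ (separating i))
  separatedAt i = ℚₚ.≰⇒> (proj₂ (separating i))

  separating-injective : ∀ {i j} → proj₁ (separating i) ≡ proj₁ (separating j) → i ≡ j
  separating-injective {i} {j} same with i Fin.≟ j
  ... | yes i≡j = i≡j
  ... | no i≢j = ⊥-elim (noCrossing (proj₁ (separating i))
          (separatedAt i) (subst (λ k → f (upper j) k ℚ.< f (lower j) k) (sym same) (separatedAt j))
          (Equivalence.to (f-embeds _ _) (lower≤upper i≢j))
          (Equivalence.to (f-embeds _ _) (lower≤upper (i≢j ∘ sym))))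

module _ (Γ : Digraph) where
  open Digraph Γ

  saturated⇒maximal : ∀ {X Y} → Orthogonal Γ X Y →
    (∀ v → X v ≡ false → Y v ≡ true ⊎ ∃[ y ] Y y ≡ true × E v y) →
    (∀ v → Y v ≡ false → X v ≡ true ⊎ ∃[ x ] X x ≡ true × E x v) →
    MaximalOrthogonal Γ X Y
  saturated⇒maximal {X} {Y} XY-orthogonal X-saturated Y-saturated =
    XY-orthogonal , λ X′ Y′ X′Y′-orthogonal X⊆X′ Y⊆Y′ →
      X′⊆X X′Y′-orthogonal Y⊆Y′ , Y′⊆Y X′Y′-orthogonal X⊆X′
    where
    X′⊆X : ∀ {X′ Y′} → Orthogonal Γ X′ Y′ → _⊆_ Γ Y Y′ → _⊆_ Γ X′ X
    X′⊆X (disjoint , noEdge) Y⊆Y′ v v∈X′ with X v in v∉X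
    ... | true = refl
    ... | false with X-saturated v v∉X
    ...   | inj₁ v∈Y = ⊥-elim (disjoint v v∈X′ (Y⊆Y′ v v∈Y))
    ...   | inj₂ (y , y∈Y , v→y) = ⊥-elim (noEdge v y v∈X′ (Y⊆Y′ y y∈Y) v→y)

    Y′⊆Y : ∀ {X′ Y′} → Orthogonal Γ X′ Y′ → _⊆_ Γ X X′ → _⊆_ Γ Y′ Y
    Y′⊆Y (disjoint , noEdge) X⊆X′ v v∈Y′ with Y v in v∉Y
    ... | true = refl
    ... | false with Y-saturated v v∉Y
    ...   | inj₁ v∈X = ⊥-elim (disjoint v (X⊆X′ v v∈X) v∈Y′)
    ...   | inj₂ (x , x∈X , x→v) = ⊥-elim (noEdge x v (X⊆X′ x x∈X) v∈Y′ x→v)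

  maximal-absorbs : ∀ {X Y Z} → MaximalOrthogonal Γ X Y → Orthogonal Γ Z Y → _⊆_ Γ Z X
  maximal-absorbs {X} {Y} {Z} ((XY-disjoint , XY-noEdge) , maximal) (ZY-disjoint , ZY-noEdge)
                  v v∈Z =
    proj₁ (maximal X∪Z Y (disjoint , noEdge) (λ u u∈X → cong (_∨ Z u) u∈X) (λ _ u∈Y → u∈Y))
      v (trans (cong (X v ∨_) v∈Z) (∨-zeroʳ (X v)))
    where
    X∪Z : VSet Γ
    X∪Z u = X u ∨ Z u

    disjoint : ∀ u → X u ∨ Z u ≡ true → Y u ≡ true → ⊥
    disjoint u with X u in u∈X
    ... | true  = λ _ → XY-disjoint u u∈X
    ... | false = ZY-disjoint u

    noEdge : ∀ x y → X x ∨ Z x ≡ true → Y y ≡ true → ¬ E x y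
    noEdge x y with X x in x∈X
    ... | true  = λ _ → XY-noEdge x y x∈X
    ... | false = ZY-noEdge x y

  maximal-absorbs-dominated : ∀ {X Y Z x} → MaximalOrthogonal Γ X Y → X x ≡ true →
    (∀ z → Z z ≡ true → E x z) → (∀ z y → Z z ≡ true → E z y → E x y) → _⊆_ Γ Z X
  maximal-absorbs-dominated {x = x} XY-maximal@((_ , XY-noEdge) , _) x∈X x→Z Z→⇒x→ =
    maximal-absorbs XY-maximal
      ((λ z z∈Z z∈Y → XY-noEdge x z x∈X z∈Y (x→Z z z∈Z)) ,
       (λ z y z∈Z y∈Y z→y → XY-noEdge x y x∈X y∈Y (Z→⇒x→ z y z∈Z z→y)))

prefixLength : ∀ {K} → (Fin K → Bool) → ℕ
prefixLength {ℕ.zero}  r = 0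
prefixLength {ℕ.suc K} r = if r zero then ℕ.suc (prefixLength (r ∘ suc)) else 0

DownClosed : ∀ {K} → (Fin K → Bool) → Set
DownClosed r = ∀ {i j} → i Fin.< j → r j ≡ true → r i ≡ true

prefixLength-mono : ∀ {K} {r r′ : Fin K → Bool} → (∀ i → r i ≡ true → r′ i ≡ true) →
                    prefixLength r ≤ prefixLength r′
prefixLength-mono {ℕ.zero} _ = z≤n
prefixLength-mono {ℕ.suc K} {r} r⊆r′ with r zero in r₀
... | false = z≤n
... | true rewrite r⊆r′ zero r₀ = s≤s (prefixLength-mono (r⊆r′ ∘ suc))

<-prefixLength⇒true : ∀ {K} {r : Fin K → Bool} i → toℕ i < prefixLength r → r i ≡ true
<-prefixLength⇒true {ℕ.suc K} {r} i i<len with r zero in r₀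
<-prefixLength⇒true zero    _           | true = r₀
<-prefixLength⇒true (suc i) (s≤s i<len) | true = <-prefixLength⇒true i i<len

true⇒<-prefixLength : ∀ {K} {r : Fin K → Bool} → DownClosed r →
                      ∀ i → r i ≡ true → toℕ i < prefixLength r
true⇒<-prefixLength _ zero r₀ rewrite r₀ = s≤s z≤n
true⇒<-prefixLength closed (suc i) rᵢ rewrite closed (s≤s z≤n) rᵢ =
  s≤s (true⇒<-prefixLength (closed ∘ s≤s) i rᵢ)

prefixLength-reflects : ∀ {K} {r r′ : Fin K → Bool} → DownClosed r →
                        prefixLength r ≤ prefixLength r′ → ∀ i → r i ≡ true → r′ i ≡ true
prefixLength-reflects closed len≤len′ i rᵢ =
  <-prefixLength⇒true i (ℕₚ.<-≤-trans (true⇒<-prefixLength closed i rᵢ) len≤len′)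

module _ {N : ℕ} where

  -- a j is the vertex (1 , j + 1) of the paper.
  a : Fin N → GV N
  a j = (zero , j) , z≤n

  aRow : VSet (G N) → Fin N → Bool
  aRow X = X ∘ a

  aBelow : Fin N → VSet (G N)
  aBelow j ((zero , i) , _)     = toℕ i ℕ.<ᵇ toℕ j
  aBelow j ((suc zero , _) , _) = false

  aBelow⇒<-col : ∀ j v → aBelow j v ≡ true → row v ≡ 0 × col v < toℕ j
  aBelow⇒<-col j ((zero , k) , _) k<ᵇj =
    refl , ℕₚ.<ᵇ⇒< (toℕ k) (toℕ j) (Equivalence.from T-≡ k<ᵇj)
  aBelow⇒<-col j ((suc zero , _) , _) ()

  aRow-downClosed : ∀ {X Y} → MaximalOrthogonal (G N) X Y → DownClosed (aRow X)
  aRow-downClosed XY-maximal {i} {j} i<j aⱼ∈X =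
    maximal-absorbs-dominated (G N) XY-maximal aⱼ∈X aⱼ→below below→⇒aⱼ→
      (a i) (Equivalence.to T-≡ (ℕₚ.<⇒<ᵇ i<j))
    where
    aⱼ→below : ∀ v → aBelow j v ≡ true → GE (a j) v
    aⱼ→below v v∈aBelow = inj₂ (refl , aBelow⇒<-col j v v∈aBelow)

    below→⇒aⱼ→ : ∀ v w → aBelow j v ≡ true → GE v w → GE (a j) w
    below→⇒aⱼ→ v w v∈aBelow v→w with aBelow⇒<-col j v v∈aBelow | v→w
    ... | v₀ , _   | inj₁ (v₁ , _)       = contradiction (trans (sym v₀) v₁) ℕₚ.0≢1+n
    ... | _ , v<j  | inj₂ (_ , w₀ , w<v) = inj₂ (refl , w₀ , ℕₚ.<-trans w<v v<j)

module _ {N : ℕ} (m : ℕ) (β : Fin N → Bool) where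

  pairX : VSet (G N)
  pairX ((zero , j) , _)     = toℕ j ℕ.<ᵇ m
  pairX ((suc zero , j) , _) = β j

  pairY : VSet (G N)
  pairY ((zero , j) , _)     = not (toℕ j ℕ.<ᵇ m) ∧ not (β j)
  pairY ((suc zero , j) , _) = not (β j)

  a∈pairX⇔ : ∀ {j} → pairX (a j) ≡ true ⇔ toℕ j < m
  a∈pairX⇔ {j} = mk⇔ (ℕₚ.<ᵇ⇒< (toℕ j) m ∘ Equivalence.from T-≡) (Equivalence.to T-≡ ∘ ℕₚ.<⇒<ᵇ)

  a∈pairY⇔ : ∀ {j} → pairY (a j) ≡ true ⇔ (¬ toℕ j < m × β j ≡ false)
  a∈pairY⇔ {j} with toℕ j ℕ.<ᵇ m | ℕₚ.<ᵇ-reflects-< (toℕ j) m | β j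
  ... | true  | ofʸ j<m | _     = mk⇔ (λ ()) (λ (j≮m , _) → contradiction j<m j≮m)
  ... | false | ofⁿ j≮m | false = mk⇔ (λ _ → j≮m , refl) (λ _ → refl)
  ... | false | ofⁿ _   | true  = mk⇔ (λ ()) (λ ())

  pair-orthogonal : Orthogonal (G N) pairX pairY
  pair-orthogonal = disjoint , noEdge
    where
    disjoint : ∀ v → pairX v ≡ true → pairY v ≡ true → ⊥
    disjoint ((zero , j) , z≤n) aⱼ∈X aⱼ∈Y =
      proj₁ (Equivalence.to a∈pairY⇔ aⱼ∈Y) (Equivalence.to a∈pairX⇔ aⱼ∈X)
    disjoint ((suc zero , j) , _) with β j
    ... | true  = λ _ ()
    ... | false = λ ()

    noEdge : ∀ x y → pairX x ≡ true → pairY y ≡ true → ¬ GE x y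
    noEdge ((zero , j) , z≤n) ((zero , k) , z≤n) aⱼ∈X aₖ∈Y (inj₂ (_ , _ , k<j)) =
      proj₁ (Equivalence.to a∈pairY⇔ aₖ∈Y) (ℕₚ.<-trans k<j (Equivalence.to a∈pairX⇔ aⱼ∈X))
    noEdge ((suc zero , j) , _) ((zero , k) , z≤n) bⱼ∈X aₖ∈Y (inj₁ (_ , _ , j≡k))
      with refl ← Finₚ.toℕ-injective j≡k =
      not-¬ bⱼ∈X (proj₂ (Equivalence.to a∈pairY⇔ aₖ∈Y))

  -- The a-vertex in column m has all its out-neighbours in X, so it must lie in Y,
  -- which excludes the b-vertex above it from X.
  pair-maximal : (∀ j → toℕ j ≡ m → β j ≡ false) → MaximalOrthogonal (G N) pairX pairY
  pair-maximal βₘ≡false = saturated⇒maximal (G N) pair-orthogonal X-saturated Y-saturated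
    where
    X-saturated : ∀ v → pairX v ≡ false → pairY v ≡ true ⊎ ∃[ y ] pairY y ≡ true × GE v y
    X-saturated ((zero , j) , z≤n) aⱼ∉X with toℕ j <? m | β j Bool.≟ false
    ... | yes j<m | _           = contradiction aⱼ∉X (not-¬ (Equivalence.from a∈pairX⇔ j<m))
    ... | no j≮m  | yes βⱼ      = inj₁ (Equivalence.from a∈pairY⇔ (j≮m , βⱼ))
    ... | no j≮m  | no βⱼ≢false =
      inj₂ (a mᶠ , Equivalence.from a∈pairY⇔ (m≮m , βₘ≡false mᶠ toℕ-mᶠ) ,
            inj₂ (refl , refl , subst (_< toℕ j) (sym toℕ-mᶠ) m<j))
      where
      m<j : m < toℕ j
      m<j = ℕₚ.≤∧≢⇒< (ℕₚ.≮⇒≥ j≮m) (λ m≡j → βⱼ≢false (βₘ≡false j (sym m≡j)))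
      m<N : m < N
      m<N = ℕₚ.<-trans m<j (Finₚ.toℕ<n j)
      mᶠ : Fin N
      mᶠ = fromℕ< m<N
      toℕ-mᶠ : toℕ mᶠ ≡ m
      toℕ-mᶠ = Finₚ.toℕ-fromℕ< m<N
      m≮m : ¬ toℕ mᶠ < m
      m≮m = ℕₚ.<-irrefl toℕ-mᶠ
    X-saturated ((suc zero , j) , _) bⱼ∉X = inj₁ (cong not bⱼ∉X)

    Y-saturated : ∀ v → pairY v ≡ false → pairX v ≡ true ⊎ ∃[ x ] pairX x ≡ true × GE x v
    Y-saturated ((zero , j) , z≤n) aⱼ∉Y with toℕ j <? m | β j Bool.≟ false
    ... | yes j<m | _      = inj₁ (Equivalence.from a∈pairX⇔ j<m)
    ... | no j≮m  | yes βⱼ = contradiction aⱼ∉Y (not-¬ (Equivalence.from a∈pairY⇔ (j≮m , βⱼ)))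
    ... | no j≮m  | no βⱼ≢false with j
    ...   | zero  = contradiction (βₘ≡false zero (sym (ℕₚ.n≤0⇒n≡0 (ℕₚ.≮⇒≥ j≮m)))) βⱼ≢false
    ...   | suc k =
      inj₂ (((suc zero , suc k) , s≤s z≤n) , ¬-not βⱼ≢false , inj₁ (refl , refl , refl))
    Y-saturated ((suc zero , j) , _) with β j
    ... | true  = λ _ → inj₁ refl
    ... | false = λ ()

pair : ∀ {N} m (β : Fin N → Bool) → (∀ j → toℕ j ≡ m → β j ≡ false) → Hoch N
pair m β βₘ≡false = (pairX m β , pairY m β) , pair-maximal m β βₘ≡false

Xpart : ∀ {N} → Hoch N → VSet (G N)
Xpart = proj₁ ∘ proj₁

indicator : Bool → ℕ
indicator false = 0
indicator true  = 1

indicator-≤⇔ : ∀ x y → (x ≡ true → y ≡ true) ⇔ indicator x ≤ indicator y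
indicator-≤⇔ false _     = mk⇔ (λ _ → z≤n) (λ _ ())
indicator-≤⇔ true  true  = mk⇔ (λ _ → s≤s z≤n) (λ _ _ → refl)
indicator-≤⇔ true  false = mk⇔ (λ x⇒y → contradiction (x⇒y refl) λ ()) (λ ())

module _ {n : ℕ} where

  -- b k is the vertex (2 , k + 2) of the paper.
  b : Fin n → GV (ℕ.suc n)
  b k = (suc zero , suc k) , s≤s z≤n

  coordinates : Hoch (ℕ.suc n) → Fin (ℕ.suc n) → ℕ
  coordinates p zero    = prefixLength (aRow (Xpart p))
  coordinates p (suc k) = indicator (Xpart p (b k))

  ≤Hoch⇔coordinates : ∀ p q → p ≤Hoch q ⇔ (∀ k → coordinates p k ≤ coordinates q k)
  ≤Hoch⇔coordinates p q = mk⇔ to from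
    where
    to : p ≤Hoch q → ∀ k → coordinates p k ≤ coordinates q k
    to p⊆q zero    = prefixLength-mono (p⊆q ∘ a)
    to p⊆q (suc k) = Equivalence.to (indicator-≤⇔ _ _) (p⊆q (b k))

    from : (∀ k → coordinates p k ≤ coordinates q k) → p ≤Hoch q
    from p≤q ((zero , j) , z≤n) =
      prefixLength-reflects {r′ = aRow (Xpart q)} (aRow-downClosed (proj₂ p)) (p≤q zero) j
    from p≤q ((suc zero , suc k) , s≤s z≤n) = Equivalence.from (indicator-≤⇔ _ _) (p≤q (suc k))

  hochStandardExample : StandardExample (Hoch (ℕ.suc n)) _≤Hoch_ (ℕ.suc n)
  hochStandardExample = record
    { lower = lower ; upper = upper ; lower≤upper = lower≤upper ; lower≰upper = lower≰upper }
    where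
    lower upper : Fin (ℕ.suc n) → Hoch (ℕ.suc n)
    only allBut : Fin (ℕ.suc n) → Fin (ℕ.suc n) → Bool
    only i c   = does (c Fin.≟ i)
    allBut i c = not (only i c)

    -- Their X parts: lower 0 = {a 0}, lower (suc i) = {b i}, upper 0 = all b-vertices,
    -- upper (suc i) = all vertices but b i.
    lower zero    = pair 1 (λ _ → false) (λ _ _ → refl)
    lower (suc i) = pair 0 (only (suc i)) λ { zero _ → refl ; (suc _) () }
    upper zero    = pair 0 (allBut zero) λ { zero _ → refl ; (suc _) () }
    upper (suc i) = pair (ℕ.suc n) (allBut (suc i))
                      (λ c c≡N → contradiction c≡N (ℕₚ.<⇒≢ (Finₚ.toℕ<n c)))

    lower≤upper : ∀ {i j} → i ≢ j → lower i ≤Hoch upper j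
    lower≤upper {zero}  {zero}  i≢j = contradiction refl i≢j
    lower≤upper {zero}  {suc j} _ ((zero , c) , z≤n) _ =
      Equivalence.from (a∈pairX⇔ (ℕ.suc n) (allBut (suc j))) (Finₚ.toℕ<n c)
    lower≤upper {zero}  {suc _} _ ((suc zero , _) , _) ()
    lower≤upper {suc _} {zero}  _ ((suc zero , suc _) , _) _ = refl
    lower≤upper {suc i} {suc j} i≢j ((suc zero , c) , _) c∈lower with c Fin.≟ suc i
    lower≤upper {suc i} {suc j} i≢j ((suc zero , c) , _) () | no _
    ... | yes refl with i Fin.≟ j
    ...   | yes i≡j = contradiction (cong suc i≡j) i≢j
    ...   | no _    = refl

    lower≰upper : ∀ i → ¬ lower i ≤Hoch upper i
    lower≰upper zero    lower⊆upper = contradiction (lower⊆upper (a zero) refl) λ ()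
    lower≰upper (suc i) lower⊆upper =
      not-¬ (lower⊆upper (b i) i≟i) (cong not i≟i)
      where i≟i = dec-true (suc i Fin.≟ suc i) refl

proposition4p3 : (n : ℕ) → 0 < n → OrderDimension (Hoch n) (_≤Hoch_ {n}) n
proposition4p3 (ℕ.suc n) _ =
  EmbedsIn-viaℕ coordinates ≤Hoch⇔coordinates ,
  λ d → standardExample⇒≤dimension hochStandardExample
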